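{- $\pi(K_5^{3- }) \geq \frac{46}{81}$.
   Context: $K_5^{3- }$ is the $3$-uniform hypergraph on $5$ vertices obtained from the complete $3$-uniform hypergraph $K^3_5$ by removing one edge. For a $3$-uniform hypergraph $G$, $t(n,G)$ denotes the maximum number of edges in a $3$-uniform hypergraph on $n$ vertices not containing $G$ as a subhypergraph, and the Turán density is $\pi(G)=\lim_{n\to\infty} t(n,G)/\binom{n}{3}$. -}

module Defs where

open import Data.Bool using (Bool; true; false; if_then_else_)
open import Data.Nat using (ℕ; zero; suc; _<_; _≤_)
open import Data.Nat.Combinatorics using (_C_)
open import Data.Fin using (Fin; toℕ)
open import Data.Fin.Patterns
open import Data.List using (List; []; _∷_; concatMap; map; allFin)
open import Data.Nat.ListAction using (sum)
open import Data.Product using (_×_; _,_; ∃; Σ)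
open import Data.Integer using (+_)
open import Data.Rational using (ℚ; _/_; _-_; _*_; _>_)
import Data.Rational as ℚ
open import Function.Definitions using (Injective)
open import Relation.Binary.PropositionalEquality using (_≡_; _≢_)
open import Relation.Nullary using (¬_; does)
open import Data.Nat using (_<?_)

-- Values on triples with repeated
-- vertices are irrelevant (never consulted).
record 3Graph (n : ℕ) : Set where
  field
    edge   : Fin n → Fin n → Fin n → Bool
    sym₁₂  : ∀ a b c → edge a b c ≡ edge b a c
    sym₂₃  : ∀ a b c → edge a b c ≡ edge a c b
open 3Graph public

increasingTriples : (n : ℕ) → List (Fin n × Fin n × Fin n)
increasingTriples n =
  concatMap (λ a → concatMap (λ b → concatMap (λ c →
    if does (toℕ a <? toℕ b) then (if does (toℕ b <? toℕ c) then (a , b , c) ∷ [] else []) else [])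
    (allFin n)) (allFin n)) (allFin n)

numEdges : ∀ {n} → 3Graph n → ℕ
numEdges {n} H = sum (map (λ { (a , b , c) → if edge H a b c then 1 else 0 }) (increasingTriples n))

ContainsK5minus : ∀ {n} → 3Graph n → Set
ContainsK5minus {n} H =
  Σ (Fin 5 → Fin n) λ f → Injective _≡_ _≡_ f ×
    (∀ (i j k : Fin 5) → toℕ i < toℕ j → toℕ j < toℕ k →
      ¬ (i ≡ 0F × j ≡ 1F × k ≡ 2F) → edge H (f i) (f j) (f k) ≡ true)

K5minusFree : ∀ {n} → 3Graph n → Set
K5minusFree H = ¬ ContainsK5minus H

toℚ : ℕ → ℚ
toℚ m = (+ m) / 1

{-# OPTIONS --safe #-}
module Submission where

-- The graphs are blow-ups of a 9-vertex pattern P₉ whose vertices form three parts of three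
-- slots: a triple inside one part is an edge iff it meets three different slots, and any other
-- triple is an edge iff its multiset of parts is {0,1,2} or {x,x,x+1} (mod 3). The pattern is
-- also consulted on triples with repeated vertices, since a blow-up identifies whole classes.
-- An exhaustive check shows that no map Fin 5 → Fin 9, injective or not, sends the nine edges
-- of K₅³⁻ to edges of P₉, so no blow-up contains K₅³⁻. P₉ has 423 of the 9³ ordered triples as
-- edges; counting ordered triples in the blow-up on n ≥ 9m vertices gives 6e ≥ 423m³ − 3n², an
-- edge density of 423/729 − O(1/n) = 47/81 − O(1/n), which exceeds 46/81 once n ≥ 3870.

open import Data.Bool using (Bool; true; false; if_then_else_; _∧_; not)
open import Data.Fin using (Fin; toℕ)
open import Data.Fin.Patterns
open import Data.Product using (Σ; _×_; _,_)
open import Function using (_∘_)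
open import Relation.Binary.PropositionalEquality
open import Defs

module Sums where
  open import Data.Nat
  open import Data.Nat.Properties
  open import Data.Nat.Tactic.RingSolver using (solve-∀)
  open import Algebra.Properties.CommutativeSemigroup +-commutativeSemigroup using (interchange)

  ∑ : ℕ → (ℕ → ℕ) → ℕ
  ∑ zero    f = 0
  ∑ (suc n) f = f 0 + ∑ n (f ∘ suc)

  syntax ∑ n (λ i → e) = ∑[ i < n ] e

  ∑-cong : ∀ n {f g : ℕ → ℕ} → (∀ i → f i ≡ g i) → ∑ n f ≡ ∑ n g
  ∑-cong zero    f≡g = refl
  ∑-cong (suc n) f≡g = cong₂ _+_ (f≡g 0) (∑-cong n (f≡g ∘ suc))

  ∑-mono-≤ : ∀ n {f g : ℕ → ℕ} → (∀ i → f i ≤ g i) → ∑ n f ≤ ∑ n g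
  ∑-mono-≤ zero    f≤g = z≤n
  ∑-mono-≤ (suc n) f≤g = +-mono-≤ (f≤g 0) (∑-mono-≤ n (f≤g ∘ suc))

  ∑-const : ∀ n k → ∑[ i < n ] k ≡ n * k
  ∑-const zero    k = refl
  ∑-const (suc n) k = cong (k +_) (∑-const n k)

  ∑-distrib-+ : ∀ n (f g : ℕ → ℕ) → ∑[ i < n ] (f i + g i) ≡ ∑ n f + ∑ n g
  ∑-distrib-+ zero    f g = refl
  ∑-distrib-+ (suc n) f g =
    trans (cong (f 0 + g 0 +_) (∑-distrib-+ n (f ∘ suc) (g ∘ suc))) (interchange (f 0) (g 0) _ _)

  *-distribˡ-∑ : ∀ n k (f : ℕ → ℕ) → k * ∑ n f ≡ ∑[ i < n ] (k * f i)
  *-distribˡ-∑ zero    k f = *-zeroʳ k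
  *-distribˡ-∑ (suc n) k f =
    trans (*-distribˡ-+ k (f 0) _) (cong (k * f 0 +_) (*-distribˡ-∑ n k (f ∘ suc)))

  ∑-++ : ∀ m n (f : ℕ → ℕ) → ∑ (m + n) f ≡ ∑ m f + ∑[ i < n ] f (m + i)
  ∑-++ zero    n f = refl
  ∑-++ (suc m) n f = trans (cong (f 0 +_) (∑-++ m n (f ∘ suc))) (sym (+-assoc (f 0) _ _))

  ∑-comm : ∀ m n (f : ℕ → ℕ → ℕ) → ∑[ i < m ] ∑[ j < n ] f i j ≡ ∑[ j < n ] ∑[ i < m ] f i j
  ∑-comm zero    n f = sym (trans (∑-const n 0) (*-zeroʳ n))
  ∑-comm (suc m) n f = trans (cong (∑ n (f 0) +_) (∑-comm m n (f ∘ suc)))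
                             (sym (∑-distrib-+ n (f 0) _))

  ∑-monoˡ-≤ : ∀ {m n} (f : ℕ → ℕ) → m ≤ n → ∑ m f ≤ ∑ n f
  ∑-monoˡ-≤ {m} {n} f m≤n = begin
    ∑ m f                                  ≤⟨ m≤m+n (∑ m f) _ ⟩
    ∑ m f + ∑[ i < n ∸ m ] f (m + i)       ≡⟨ ∑-++ m (n ∸ m) f ⟨
    ∑ (m + (n ∸ m)) f                      ≡⟨ cong (λ l → ∑ l f) (m+[n∸m]≡n m≤n) ⟩
    ∑ n f                                  ∎
    where open ≤-Reasoning

  ∑-periodic : ∀ m k {f : ℕ → ℕ} → (∀ i → f (k + i) ≡ f i) → ∑ (m * k) f ≡ m * ∑ k f
  ∑-periodic zero    k f-per = refl
  ∑-periodic (suc m) k f-per =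
    trans (∑-++ k (m * k) _) (cong (∑ k _ +_) (trans (∑-cong (m * k) f-per) (∑-periodic m k f-per)))

  ∑-periodic-≤ : ∀ m k {n} (f : ℕ → ℕ) → (∀ i → f (k + i) ≡ f i) → m * k ≤ n → m * ∑ k f ≤ ∑ n f
  ∑-periodic-≤ m k {n} f f-per mk≤n =
    subst (_≤ ∑ n f) (∑-periodic m k f-per) (∑-monoˡ-≤ f mk≤n)

  ∑³ : ℕ → (ℕ → ℕ → ℕ → ℕ) → ℕ
  ∑³ n f = ∑[ a < n ] ∑[ b < n ] ∑[ c < n ] f a b c

  ∑³-mono-≤ : ∀ n {f g : ℕ → ℕ → ℕ → ℕ} → (∀ a b c → f a b c ≤ g a b c) → ∑³ n f ≤ ∑³ n g
  ∑³-mono-≤ n f≤g = ∑-mono-≤ n λ a → ∑-mono-≤ n λ b → ∑-mono-≤ n λ c → f≤g a b c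

  ∑³-distrib-+ : ∀ n (f g : ℕ → ℕ → ℕ → ℕ) →
                 ∑³ n (λ a b c → f a b c + g a b c) ≡ ∑³ n f + ∑³ n g
  ∑³-distrib-+ n f g = trans
    (∑-cong n λ a → trans (∑-cong n λ b → ∑-distrib-+ n (f a b) (g a b))
                          (∑-distrib-+ n (λ b → ∑ n (f a b)) (λ b → ∑ n (g a b))))
    (∑-distrib-+ n _ _)

  ∑³-swap₁₂ : ∀ n (f : ℕ → ℕ → ℕ → ℕ) → ∑³ n (λ a b c → f b a c) ≡ ∑³ n f
  ∑³-swap₁₂ n f = ∑-comm n n (λ a b → ∑[ c < n ] f b a c)

  ∑³-swap₂₃ : ∀ n (f : ℕ → ℕ → ℕ → ℕ) → ∑³ n (λ a b c → f a c b) ≡ ∑³ n f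
  ∑³-swap₂₃ n f = ∑-cong n λ a → ∑-comm n n (λ b c → f a c b)

  ∑³-rotate : ∀ n (f : ℕ → ℕ → ℕ → ℕ) → ∑³ n (λ a b c → f b c a) ≡ ∑³ n f
  ∑³-rotate n f = trans (∑³-swap₁₂ n (λ a b c → f a c b)) (∑³-swap₂₃ n f)

  record Periodic (k : ℕ) (f : ℕ → ℕ → ℕ → ℕ) : Set where
    field
      shift₁ : ∀ a b c → f (k + a) b c ≡ f a b c
      shift₂ : ∀ a b c → f a (k + b) c ≡ f a b c
      shift₃ : ∀ a b c → f a b (k + c) ≡ f a b c

  ∑³-periodic-≤ : ∀ {k m n} {f : ℕ → ℕ → ℕ → ℕ} → Periodic k f → m * k ≤ n →
                  m ^ 3 * ∑³ k f ≤ ∑³ n f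
  ∑³-periodic-≤ {k} {m} {n} {f} per mk≤n = begin
    m ^ 3 * ∑³ k f
      ≡⟨ cube-assoc m (∑³ k f) ⟩
    m * (m * (m * ∑³ k f))
      ≡⟨ cong (λ l → m * (m * l)) (*-distribˡ-∑ k m _) ⟩
    m * (m * ∑[ a < k ] (m * ∑[ b < k ] ∑[ c < k ] f a b c))
      ≡⟨ cong (m *_) (*-distribˡ-∑ k m _) ⟩
    m * ∑[ a < k ] (m * (m * ∑[ b < k ] ∑[ c < k ] f a b c))
      ≡⟨ cong (m *_) (∑-cong k λ a → cong (m *_) (*-distribˡ-∑ k m _)) ⟩
    m * ∑[ a < k ] (m * ∑[ b < k ] (m * ∑[ c < k ] f a b c))
      ≤⟨ *-monoʳ-≤ m (∑-mono-≤ k λ a → *-monoʳ-≤ m (∑-mono-≤ k λ b →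
           ∑-periodic-≤ m k (f a b) (shift₃ a b) mk≤n)) ⟩
    m * ∑[ a < k ] (m * ∑[ b < k ] ∑[ c < n ] f a b c)
      ≤⟨ *-monoʳ-≤ m (∑-mono-≤ k λ a →
           ∑-periodic-≤ m k _ (λ b → ∑-cong n (shift₂ a b)) mk≤n) ⟩
    m * ∑[ a < k ] ∑[ b < n ] ∑[ c < n ] f a b c
      ≤⟨ ∑-periodic-≤ m k _ (λ a → ∑-cong n λ b → ∑-cong n (shift₁ a b)) mk≤n ⟩
    ∑³ n f ∎
    where
    open ≤-Reasoning
    open Periodic per
    cube-assoc : ∀ x y → x * (x * (x * 1)) * y ≡ x * (x * (x * y))
    cube-assoc = solve-∀

module OrderedTriples where
  open import Data.Nat
  open import Data.Nat.Properties
  open import Data.Nat.Tactic.RingSolver using (solve-∀)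
  open import Data.Sum using (inj₁; inj₂)
  open import Data.List as List using (List; concatMap; map; allFin; tabulate)
  open import Data.List.Properties using (map-++; map-tabulate)
  open import Data.Nat.ListAction using (sum)
  open import Data.Nat.ListAction.Properties using (sum-++)
  import Data.Fin as Fin
  open import Relation.Nullary using (does)
  open import Relation.Nullary.Decidable using (dec-true)
  open Sums

  record Symmetric (f : ℕ → ℕ → ℕ → ℕ) : Set where
    field
      swap₁₂ : ∀ a b c → f a b c ≡ f b a c
      swap₂₃ : ∀ a b c → f a b c ≡ f a c b

  +-symmetric : ∀ {f g} → Symmetric f → Symmetric g → Symmetric (λ a b c → f a b c + g a b c)
  +-symmetric sf sg = record
    { swap₁₂ = λ a b c → cong₂ _+_ (swap₁₂ sf a b c) (swap₁₂ sg a b c)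
    ; swap₂₃ = λ a b c → cong₂ _+_ (swap₂₃ sf a b c) (swap₂₃ sg a b c)
    }
    where open Symmetric

  sorted-wlog : ∀ {f g} → Symmetric f → Symmetric g →
                (∀ {a b c} → a ≤ b → b ≤ c → f a b c ≤ g a b c) → ∀ a b c → f a b c ≤ g a b c
  sorted-wlog {f} {g} sf sg sorted = go
    where
    open Symmetric
    from₁₂ : ∀ {a b c} → f b a c ≤ g b a c → f a b c ≤ g a b c
    from₁₂ = subst₂ _≤_ (sym (swap₁₂ sf _ _ _)) (sym (swap₁₂ sg _ _ _))
    from₂₃ : ∀ {a b c} → f a c b ≤ g a c b → f a b c ≤ g a b c
    from₂₃ = subst₂ _≤_ (sym (swap₂₃ sf _ _ _)) (sym (swap₂₃ sg _ _ _))
    go : ∀ a b c → f a b c ≤ g a b c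
    go a b c with ≤-total a b | ≤-total b c | ≤-total a c
    ... | inj₁ a≤b | inj₁ b≤c | _        = sorted a≤b b≤c
    ... | inj₁ a≤b | inj₂ c≤b | inj₁ a≤c = from₂₃ (sorted a≤c c≤b)
    ... | inj₁ a≤b | inj₂ c≤b | inj₂ c≤a = from₂₃ (from₁₂ (sorted c≤a a≤b))
    ... | inj₂ b≤a | inj₁ b≤c | inj₁ a≤c = from₁₂ (sorted b≤a a≤c)
    ... | inj₂ b≤a | inj₁ b≤c | inj₂ c≤a = from₁₂ (from₂₃ (sorted b≤c c≤a))
    ... | inj₂ b≤a | inj₂ c≤b | _        = from₁₂ (from₂₃ (from₁₂ (sorted c≤b b≤a)))

  rotationSum : (ℕ → ℕ → ℕ → ℕ) → ℕ → ℕ → ℕ → ℕ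
  rotationSum h a b c = h a b c + (h b c a + h c a b)

  permutationSum : (ℕ → ℕ → ℕ → ℕ) → ℕ → ℕ → ℕ → ℕ
  permutationSum h a b c = rotationSum h a b c + rotationSum h a c b

  rotationSum-rotate : ∀ h a b c → rotationSum h b c a ≡ rotationSum h a b c
  rotationSum-rotate h a b c =
    trans (sym (+-assoc (h b c a) (h c a b) (h a b c))) (+-comm (h b c a + h c a b) (h a b c))

  rotationSum-symmetric : ∀ {h} → (∀ a b c → h a b c ≡ h b a c) → Symmetric (rotationSum h)
  rotationSum-symmetric {h} h-swap = record
    { swap₁₂ = λ a b c → cong₂ _+_ (h-swap a b c) (trans (+-comm (h b c a) (h c a b))
                           (cong₂ _+_ (h-swap c a b) (h-swap b c a)))
    ; swap₂₃ = λ a b c → trans (reverse (h a b c) (h b c a) (h c a b))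
                           (cong₂ _+_ (h-swap c a b) (cong₂ _+_ (h-swap b c a) (h-swap a b c)))
    }
    where
    reverse : ∀ x y z → x + (y + z) ≡ z + (y + x)
    reverse = solve-∀

  permutationSum-symmetric : ∀ h → Symmetric (permutationSum h)
  permutationSum-symmetric h = record
    { swap₁₂ = λ a b c → trans (cong₂ _+_ (sym (rotationSum-rotate h a b c)) (rotationSum-rotate h b a c))
                               (+-comm (rotationSum h b c a) (rotationSum h b a c))
    ; swap₂₃ = λ a b c → +-comm (rotationSum h a b c) (rotationSum h a c b)
    }

  ∑³-rotationSum : ∀ n h → ∑³ n (rotationSum h) ≡ 3 * ∑³ n h
  ∑³-rotationSum n h = begin
    ∑³ n (rotationSum h)
      ≡⟨ ∑³-distrib-+ n h _ ⟩
    ∑³ n h + ∑³ n (λ a b c → h b c a + h c a b)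
      ≡⟨ cong (∑³ n h +_) (∑³-distrib-+ n (λ a b c → h b c a) (λ a b c → h c a b)) ⟩
    ∑³ n h + (∑³ n (λ a b c → h b c a) + ∑³ n (λ a b c → h c a b))
      ≡⟨ cong (λ s → ∑³ n h + (∑³ n (λ a b c → h b c a) + s))
              (trans (∑³-rotate n (λ a b c → h b c a)) (∑³-rotate n h)) ⟩
    ∑³ n h + (∑³ n (λ a b c → h b c a) + ∑³ n h)
      ≡⟨ cong (λ s → ∑³ n h + (s + ∑³ n h)) (∑³-rotate n h) ⟩
    ∑³ n h + (∑³ n h + ∑³ n h)
      ≡⟨ cong (λ s → ∑³ n h + (∑³ n h + s)) (+-identityʳ (∑³ n h)) ⟨
    3 * ∑³ n h ∎
    where open ≡-Reasoning

  ∑³-permutationSum : ∀ n h → ∑³ n (permutationSum h) ≡ 6 * ∑³ n h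
  ∑³-permutationSum n h = begin
    ∑³ n (permutationSum h)
      ≡⟨ ∑³-distrib-+ n (rotationSum h) _ ⟩
    ∑³ n (rotationSum h) + ∑³ n (λ a b c → rotationSum h a c b)
      ≡⟨ cong (∑³ n (rotationSum h) +_) (∑³-swap₂₃ n (rotationSum h)) ⟩
    ∑³ n (rotationSum h) + ∑³ n (rotationSum h)
      ≡⟨ cong₂ _+_ (∑³-rotationSum n h) (∑³-rotationSum n h) ⟩
    3 * ∑³ n h + 3 * ∑³ n h
      ≡⟨ *-distribʳ-+ (∑³ n h) 3 3 ⟨
    6 * ∑³ n h ∎
    where open ≡-Reasoning

  δ : ℕ → ℕ → ℕ
  δ a b = if a ≡ᵇ b then 1 else 0

  δ-comm : ∀ a b → δ a b ≡ δ b a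
  δ-comm zero    zero    = refl
  δ-comm zero    (suc b) = refl
  δ-comm (suc a) zero    = refl
  δ-comm (suc a) (suc b) = δ-comm a b

  δ-refl : ∀ a → δ a a ≡ 1
  δ-refl zero    = refl
  δ-refl (suc a) = δ-refl a

  ∑-δ≤1 : ∀ n a → ∑[ c < n ] δ a c ≤ 1
  ∑-δ≤1 zero    a       = z≤n
  ∑-δ≤1 (suc n) zero    = ≤-reflexive (cong suc (trans (∑-const n 0) (*-zeroʳ n)))
  ∑-δ≤1 (suc n) (suc a) = ∑-δ≤1 n a

  coincidence : ℕ → ℕ → ℕ → ℕ
  coincidence a b _ = δ a b

  ∑³-coincidence≤ : ∀ n → ∑³ n coincidence ≤ n ^ 2
  ∑³-coincidence≤ n = begin
    ∑³ n coincidence                      ≡⟨ ∑³-swap₂₃ n coincidence ⟨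
    ∑[ a < n ] ∑[ b < n ] ∑[ c < n ] δ a c ≤⟨ ∑-mono-≤ n (λ a → ∑-mono-≤ n λ _ → ∑-δ≤1 n a) ⟩
    ∑[ a < n ] ∑[ b < n ] 1               ≡⟨ ∑-cong n (λ _ → ∑-const n 1) ⟩
    ∑[ a < n ] (n * 1)                    ≡⟨ ∑-const n (n * 1) ⟩
    n ^ 2                                 ∎
    where open ≤-Reasoning

  increasing : (ℕ → ℕ → ℕ → ℕ) → ℕ → ℕ → ℕ → ℕ
  increasing f a b c = if does (a <? b) then (if does (b <? c) then f a b c else 0) else 0

  increasing-< : ∀ {f a b c} → a < b → b < c → increasing f a b c ≡ f a b c
  increasing-< {a = a} {b} {c} a<b b<c rewrite dec-true (a <? b) a<b | dec-true (b <? c) b<c = refl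

  ≤permutationSum+coincidences : ∀ {f} → Symmetric f → (∀ a b c → f a b c ≤ 1) → ∀ a b c →
    f a b c ≤ permutationSum (increasing f) a b c + rotationSum coincidence a b c
  ≤permutationSum+coincidences {f} sf f≤1 =
    sorted-wlog sf (+-symmetric (permutationSum-symmetric (increasing f))
                                (rotationSum-symmetric (λ a b _ → δ-comm a b)))
                sorted-bound
    where
    sorted-bound : ∀ {a b c} → a ≤ b → b ≤ c →
      f a b c ≤ permutationSum (increasing f) a b c + rotationSum coincidence a b c
    sorted-bound {a} {b} {c} a≤b b≤c with m≤n⇒m<n∨m≡n a≤b | m≤n⇒m<n∨m≡n b≤c
    ... | inj₁ a<b | inj₁ b<c = begin
      f a b c                                  ≡⟨ increasing-< {f} a<b b<c ⟨
      increasing f a b c                       ≤⟨ m≤m+n _ _ ⟩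
      rotationSum (increasing f) a b c         ≤⟨ m≤m+n _ _ ⟩
      permutationSum (increasing f) a b c      ≤⟨ m≤m+n _ _ ⟩
      permutationSum (increasing f) a b c + rotationSum coincidence a b c ∎
      where open ≤-Reasoning
    ... | inj₂ refl | _ = begin
      f a a c                                  ≤⟨ f≤1 a a c ⟩
      1                                        ≡⟨ δ-refl a ⟨
      δ a a                                    ≤⟨ m≤m+n _ _ ⟩
      rotationSum coincidence a a c            ≤⟨ m≤n+m _ (permutationSum (increasing f) a a c) ⟩
      permutationSum (increasing f) a a c + rotationSum coincidence a a c ∎
      where open ≤-Reasoning
    ... | inj₁ _ | inj₂ refl = begin
      f a b b                                  ≤⟨ f≤1 a b b ⟩
      1                                        ≡⟨ δ-refl b ⟨
      δ b b                                    ≤⟨ m≤m+n _ _ ⟩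
      δ b b + δ b a                            ≤⟨ m≤n+m _ (δ a b) ⟩
      rotationSum coincidence a b b            ≤⟨ m≤n+m _ (permutationSum (increasing f) a b b) ⟩
      permutationSum (increasing f) a b b + rotationSum coincidence a b b ∎
      where open ≤-Reasoning

  ∑³≤6∑³increasing+3n² : ∀ n {f} → Symmetric f → (∀ a b c → f a b c ≤ 1) →
                         ∑³ n f ≤ 6 * ∑³ n (increasing f) + 3 * n ^ 2
  ∑³≤6∑³increasing+3n² n {f} sf f≤1 = begin
    ∑³ n f
      ≤⟨ ∑³-mono-≤ n (≤permutationSum+coincidences sf f≤1) ⟩
    ∑³ n (λ a b c → permutationSum (increasing f) a b c + rotationSum coincidence a b c)
      ≡⟨ ∑³-distrib-+ n _ _ ⟩
    ∑³ n (permutationSum (increasing f)) + ∑³ n (rotationSum coincidence)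
      ≡⟨ cong₂ _+_ (∑³-permutationSum n (increasing f)) (∑³-rotationSum n coincidence) ⟩
    6 * ∑³ n (increasing f) + 3 * ∑³ n coincidence
      ≤⟨ +-monoʳ-≤ (6 * ∑³ n (increasing f)) (*-monoʳ-≤ 3 (∑³-coincidence≤ n)) ⟩
    6 * ∑³ n (increasing f) + 3 * n ^ 2 ∎
    where open ≤-Reasoning

  sum-map-concatMap : ∀ {A B : Set} (w : B → ℕ) (F : A → List B) (xs : List A) →
                      sum (map w (concatMap F xs)) ≡ sum (map (λ x → sum (map w (F x))) xs)
  sum-map-concatMap w F List.[]       = refl
  sum-map-concatMap w F (x List.∷ xs) = begin
    sum (map w (F x List.++ concatMap F xs))               ≡⟨ cong sum (map-++ w (F x) _) ⟩
    sum (map w (F x) List.++ map w (concatMap F xs))       ≡⟨ sum-++ (map w (F x)) _ ⟩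
    sum (map w (F x)) + sum (map w (concatMap F xs))       ≡⟨ cong (sum (map w (F x)) +_) (sum-map-concatMap w F xs) ⟩
    sum (map w (F x)) + sum (map (λ y → sum (map w (F y))) xs) ∎
    where open ≡-Reasoning

  sum-map-allFin : ∀ n {g : Fin n → ℕ} {h : ℕ → ℕ} → (∀ i → g i ≡ h (toℕ i)) →
                   sum (map g (allFin n)) ≡ ∑ n h
  sum-map-allFin n {g} g≡h = trans (cong sum (map-tabulate (λ i → i) g)) (sum-tabulate n g≡h)
    where
    sum-tabulate : ∀ n {g : Fin n → ℕ} {h : ℕ → ℕ} → (∀ i → g i ≡ h (toℕ i)) →
                   sum (tabulate g) ≡ ∑ n h
    sum-tabulate zero    g≡h = refl
    sum-tabulate (suc n) g≡h = cong₂ _+_ (g≡h Fin.zero) (sum-tabulate n (g≡h ∘ Fin.suc))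

  sum-concatMap-allFin : ∀ {B : Set} n (w : B → ℕ) (F : Fin n → List B) {h : ℕ → ℕ} →
                         (∀ i → sum (map w (F i)) ≡ h (toℕ i)) →
                         sum (map w (concatMap F (allFin n))) ≡ ∑ n h
  sum-concatMap-allFin n w F Fᵢ≡h = trans (sum-map-concatMap w F (allFin n)) (sum-map-allFin n Fᵢ≡h)

  numEdges≡∑³increasing : ∀ {n} (H : 3Graph n) (χ : ℕ → ℕ → ℕ → ℕ) →
    (∀ a b c → (if edge H a b c then 1 else 0) ≡ χ (toℕ a) (toℕ b) (toℕ c)) →
    numEdges H ≡ ∑³ n (increasing χ)
  numEdges≡∑³increasing {n} H χ H≡χ =
    sum-concatMap-allFin n w _ λ a →
    sum-concatMap-allFin n w _ λ b →
    sum-concatMap-allFin n w _ λ c → singleton a b c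
    where
    w : Fin n × Fin n × Fin n → ℕ
    w (a , b , c) = if edge H a b c then 1 else 0
    singleton : ∀ a b c →
      sum (map w (if does (toℕ a <? toℕ b)
                  then (if does (toℕ b <? toℕ c) then (a , b , c) List.∷ List.[] else List.[])
                  else List.[]))
      ≡ increasing χ (toℕ a) (toℕ b) (toℕ c)
    singleton a b c with toℕ a <ᵇ toℕ b | toℕ b <ᵇ toℕ c
    ... | true  | true  = trans (+-identityʳ _) (H≡χ a b c)
    ... | true  | false = refl
    ... | false | _     = refl

module BlowUp where
  open import Data.Nat
  open import Data.Nat.DivMod using (_mod_; _%_; [m+n]%n≡m%n; m/n*n≤m)
  open import Data.Nat.Properties using (+-comm; ≤-refl; module ≤-Reasoning)
  open import Data.Fin.Properties using (fromℕ<-cong)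
  open import Relation.Nullary using (¬_)
  open import Relation.Nullary.Decidable using (True; toWitness)
  open Sums
  open OrderedTriples

  pullback : ∀ {n k} → (Fin n → Fin k) → 3Graph k → 3Graph n
  pullback φ T = record
    { edge  = λ a b c → edge T (φ a) (φ b) (φ c)
    ; sym₁₂ = λ a b c → sym₁₂ T (φ a) (φ b) (φ c)
    ; sym₂₃ = λ a b c → sym₂₃ T (φ a) (φ b) (φ c)
    }

  blowUp : ∀ {k} .{{_ : NonZero k}} → 3Graph k → (n : ℕ) → 3Graph n
  blowUp {k} T n = pullback (λ a → toℕ a mod k) T

  K5minusHom : ∀ {k} → 3Graph k → (Fin 5 → Fin k) → Set
  K5minusHom T g = ∀ (i j l : Fin 5) → toℕ i < toℕ j → toℕ j < toℕ l →
                   ¬ (i ≡ 0F × j ≡ 1F × l ≡ 2F) → edge T (g i) (g j) (g l) ≡ true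

  spansK5minus : ∀ {k} → 3Graph k → (Fin 5 → Fin k) → Bool
  spansK5minus T g =
    e 0F 1F 3F ∧ e 0F 2F 3F ∧ e 1F 2F 3F ∧ e 0F 1F 4F ∧ e 0F 2F 4F ∧
    e 0F 3F 4F ∧ e 1F 2F 4F ∧ e 1F 3F 4F ∧ e 2F 3F 4F
    where
    e : Fin 5 → Fin 5 → Fin 5 → Bool
    e i j l = edge T (g i) (g j) (g l)

  K5minusHom⇒spansK5minus : ∀ {k} {T : 3Graph k} {g} → K5minusHom T g → spansK5minus T g ≡ true
  K5minusHom⇒spansK5minus {T = T} {g} hom =
    at 0F 1F 3F (λ { (_ , _ , ()) }) ∧-true
    at 0F 2F 3F (λ { (_ , () , _) }) ∧-true
    at 1F 2F 3F (λ { (() , _) })     ∧-true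
    at 0F 1F 4F (λ { (_ , _ , ()) }) ∧-true
    at 0F 2F 4F (λ { (_ , () , _) }) ∧-true
    at 0F 3F 4F (λ { (_ , () , _) }) ∧-true
    at 1F 2F 4F (λ { (() , _) })     ∧-true
    at 1F 3F 4F (λ { (() , _) })     ∧-true
    at 2F 3F 4F (λ { (() , _) })
    where
    at : ∀ i j l {i<j : True (toℕ i <? toℕ j)} {j<l : True (toℕ j <? toℕ l)} →
         ¬ (i ≡ 0F × j ≡ 1F × l ≡ 2F) → edge T (g i) (g j) (g l) ≡ true
    at i j l {i<j} {j<l} = hom i j l (toWitness i<j) (toWitness j<l)
    infixr 5 _∧-true_
    _∧-true_ : ∀ {x y} → x ≡ true → y ≡ true → x ∧ y ≡ true
    refl ∧-true refl = refl

  pullback-K5minusFree : ∀ {n k} (φ : Fin n → Fin k) (T : 3Graph k) →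
                         (∀ g → spansK5minus T g ≡ false) → K5minusFree (pullback φ T)
  pullback-K5minusFree φ T noSpan (f , _ , hom)
    with trans (sym (K5minusHom⇒spansK5minus {T = T} {g = φ ∘ f} hom)) (noSpan (φ ∘ f))
  ... | ()

  blowUp-K5minusFree : ∀ {k} .{{_ : NonZero k}} (T : 3Graph k) n →
                       (∀ g → spansK5minus T g ≡ false) → K5minusFree (blowUp T n)
  blowUp-K5minusFree {k} T n = pullback-K5minusFree (λ a → toℕ a mod k) T

  blowUpχ : ∀ {k} .{{_ : NonZero k}} → 3Graph k → ℕ → ℕ → ℕ → ℕ
  blowUpχ {k} T x y z = if edge T (x mod k) (y mod k) (z mod k) then 1 else 0

  blowUpχ≤1 : ∀ {k} .{{_ : NonZero k}} (T : 3Graph k) x y z → blowUpχ T x y z ≤ 1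
  blowUpχ≤1 {k} T x y z with edge T (x mod k) (y mod k) (z mod k)
  ... | true  = ≤-refl
  ... | false = z≤n

  blowUpχ-symmetric : ∀ {k} .{{_ : NonZero k}} (T : 3Graph k) → Symmetric (blowUpχ T)
  blowUpχ-symmetric {k} T = record
    { swap₁₂ = λ x y z → cong (λ e → if e then 1 else 0) (sym₁₂ T (x mod k) (y mod k) (z mod k))
    ; swap₂₃ = λ x y z → cong (λ e → if e then 1 else 0) (sym₂₃ T (x mod k) (y mod k) (z mod k))
    }

  mod-periodic : ∀ k .{{_ : NonZero k}} x → (k + x) mod k ≡ x mod k
  mod-periodic k x = fromℕ<-cong _ _ (trans (cong (_% k) (+-comm k x)) ([m+n]%n≡m%n x k)) _ _

  blowUpχ-periodic : ∀ {k} .{{_ : NonZero k}} (T : 3Graph k) → Periodic k (blowUpχ T)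
  blowUpχ-periodic {k} T = record
    { shift₁ = λ x y z → cong (λ v → if edge T v (y mod k) (z mod k) then 1 else 0) (mod-periodic k x)
    ; shift₂ = λ x y z → cong (λ v → if edge T (x mod k) v (z mod k) then 1 else 0) (mod-periodic k y)
    ; shift₃ = λ x y z → cong (λ v → if edge T (x mod k) (y mod k) v then 1 else 0) (mod-periodic k z)
    }

  numEdges-blowUp-≥ : ∀ {k} .{{_ : NonZero k}} (T : 3Graph k) n →
                      (n / k) ^ 3 * ∑³ k (blowUpχ T) ≤ 6 * numEdges (blowUp T n) + 3 * n ^ 2
  numEdges-blowUp-≥ {k} T n = begin
    (n / k) ^ 3 * ∑³ k (blowUpχ T)
      ≤⟨ ∑³-periodic-≤ {m = n / k} (blowUpχ-periodic T) (m/n*n≤m n k) ⟩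
    ∑³ n (blowUpχ T)
      ≤⟨ ∑³≤6∑³increasing+3n² n (blowUpχ-symmetric T) (blowUpχ≤1 T) ⟩
    6 * ∑³ n (increasing (blowUpχ T)) + 3 * n ^ 2
      ≡⟨ cong (λ e → 6 * e + 3 * n ^ 2)
              (numEdges≡∑³increasing (blowUp T n) (blowUpχ T) (λ _ _ _ → refl)) ⟨
    6 * numEdges (blowUp T n) + 3 * n ^ 2 ∎
    where open ≤-Reasoning

module NinePartPattern where
  open import Data.Nat using (_+_; _*_; _^_; _/_; _%_; _≡ᵇ_; _≤_)
  open import Data.Fin using (quotient; remainder)
  open import Data.Fin.Properties using (all?) renaming (_≟_ to _≟ᶠ_)
  open import Data.Bool.Properties using () renaming (_≟_ to _≟ᵇ_)
  open import Data.Vec.Functional using ([]; _∷_)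
  open import Relation.Nullary using (does)
  open import Relation.Nullary.Decidable using (toWitness)
  open Sums
  open BlowUp

  _==_ : ∀ {k} → Fin k → Fin k → Bool
  x == y = does (x ≟ᶠ y)

  rainbow : ∀ {k} → Fin k → Fin k → Fin k → Bool
  rainbow a b c = not (a == b) ∧ not (b == c) ∧ not (a == c)

  -- {0,1,2} and the {x,x,x+1} (mod 3) are exactly the non-constant triples with sum ≢ 2 (mod 3).
  cyclic : Fin 3 → Fin 3 → Fin 3 → Bool
  cyclic a b c = not (a == b ∧ b == c) ∧ not ((toℕ a + toℕ b + toℕ c) % 3 ≡ᵇ 2)

  part : Fin 9 → Fin 3
  part = quotient {3} 3

  slot : Fin 9 → Fin 3
  slot = remainder {3} 3

  P₉-edge : Fin 9 → Fin 9 → Fin 9 → Bool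
  P₉-edge x y z =
    if part x == part y ∧ part y == part z
    then rainbow (slot x) (slot y) (slot z)
    else cyclic (part x) (part y) (part z)

  P₉ : 3Graph 9
  P₉ = record
    { edge  = P₉-edge
    ; sym₁₂ = toWitness {a? = all? λ a → all? λ b → all? λ c → P₉-edge a b c ≟ᵇ P₉-edge b a c} _
    ; sym₂₃ = toWitness {a? = all? λ a → all? λ b → all? λ c → P₉-edge a b c ≟ᵇ P₉-edge a c b} _
    }

  P₉-spansNoK5minus : ∀ g → spansK5minus P₉ g ≡ false
  P₉-spansNoK5minus g = noQuintuple (g 0F) (g 1F) (g 2F) (g 3F) (g 4F)
    where
    noQuintuple : ∀ x₀ x₁ x₂ x₃ x₄ → spansK5minus P₉ (x₀ ∷ x₁ ∷ x₂ ∷ x₃ ∷ x₄ ∷ []) ≡ false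
    noQuintuple = toWitness {a? = all? λ x₀ → all? λ x₁ → all? λ x₂ → all? λ x₃ → all? λ x₄ →
                                  spansK5minus P₉ (x₀ ∷ x₁ ∷ x₂ ∷ x₃ ∷ x₄ ∷ []) ≟ᵇ false} _

  ∑³-blowUpχ-P₉ : ∑³ 9 (blowUpχ P₉) ≡ 423
  ∑³-blowUpχ-P₉ = refl

  numEdges-blowUp-P₉-≥ : ∀ n → (n / 9) ^ 3 * 423 ≤ 6 * numEdges (blowUp P₉ n) + 3 * n ^ 2
  numEdges-blowUp-P₉-≥ n = subst (λ s → (n / 9) ^ 3 * s ≤ 6 * numEdges (blowUp P₉ n) + 3 * n ^ 2)
                                 ∑³-blowUpχ-P₉ (numEdges-blowUp-≥ P₉ n)


module Arithmetic where
  open import Data.Nat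
  open import Data.Nat.Combinatorics using (_C_; _P_; nCk≡nPk/k!)
  open import Data.Nat.Combinatorics.Base using (_P′_)
  open import Data.Nat.DivMod
  open import Data.Nat.Properties
  open import Algebra.Properties.CommutativeSemigroup *-commutativeSemigroup using (x∙yz≈y∙xz)
  open import Data.Nat.Tactic.RingSolver using (solve-∀)

  nP′k≤n^k : ∀ n k → n P′ k ≤ n ^ k
  nP′k≤n^k n zero    = ≤-refl
  nP′k≤n^k n (suc k) = *-mono-≤ (m∸n≤m n k) (nP′k≤n^k n k)

  nPk≤n^k : ∀ n k → n P k ≤ n ^ k
  nPk≤n^k n k with k ≤ᵇ n
  ... | true  = nP′k≤n^k n k
  ... | false = z≤n

  k!*nCk≤n^k : ∀ {n k} → k ≤ n → k ! * (n C k) ≤ n ^ k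
  k!*nCk≤n^k {n} {k} k≤n = begin
    k ! * (n C k)        ≡⟨ cong (k ! *_) (nCk≡nPk/k! k≤n) ⟩
    k ! * ((n P k) / k !) ≡⟨ *-comm (k !) _ ⟩
    ((n P k) / k !) * k ! ≤⟨ m/n*n≤m (n P k) (k !) ⟩
    n P k                ≤⟨ nPk≤n^k n k ⟩
    n ^ k                ∎
    where
    open ≤-Reasoning
    instance _ = k !≢0

  quadratic≤cube : ∀ {a b c m} .{{_ : NonZero m}} → a + b + c ≤ m → a * m ^ 2 + b * m + c ≤ m ^ 3
  quadratic≤cube {a} {b} {c} {m} a+b+c≤m = begin
    a * m ^ 2 + b * m + c
      ≤⟨ +-mono-≤ (+-monoʳ-≤ (a * m ^ 2) (*-monoʳ-≤ b (m≤m*n m (m ^ 1) {{m^n≢0 m 1}})))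
                  (m≤m*n c (m ^ 2) {{m^n≢0 m 2}}) ⟩
    a * m ^ 2 + b * m ^ 2 + c * m ^ 2
      ≡⟨ collect a b c (m ^ 2) ⟩
    (a + b + c) * m ^ 2
      ≤⟨ *-monoˡ-≤ (m ^ 2) a+b+c≤m ⟩
    m ^ 3 ∎
    where
    open ≤-Reasoning
    collect : ∀ a b c x → a * x + b * x + c * x ≡ (a + b + c) * x
    collect = solve-∀

  cubic-estimate : ∀ {m} → 430 ≤ m → 46 * (1 + m) ^ 3 + 27 * (1 + m) ^ 2 ≤ 47 * m ^ 3
  cubic-estimate {m} 430≤m = +-cancelʳ-≤ (m ^ 3) _ _ (begin
    46 * (1 + m) ^ 3 + 27 * (1 + m) ^ 2 + m ^ 3
      ≡⟨ expand m ⟩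
    47 * m ^ 3 + (165 * m ^ 2 + 192 * m + 73)
      ≤⟨ +-monoʳ-≤ (47 * m ^ 3) (quadratic≤cube {165} {192} {73} 430≤m) ⟩
    47 * m ^ 3 + m ^ 3 ∎)
    where
    open ≤-Reasoning
    instance _ = >-nonZero (<-≤-trans z<s 430≤m)
    expand : ∀ m →
      46 * ((1 + m) * ((1 + m) * ((1 + m) * 1))) + 27 * ((1 + m) * ((1 + m) * 1)) + m * (m * (m * 1))
      ≡ 47 * (m * (m * (m * 1))) + (165 * (m * (m * 1)) + 192 * m + 73)
    expand = solve-∀

  ≤9*[1+n/9] : ∀ n → n ≤ 9 * (1 + n / 9)
  ≤9*[1+n/9] n = begin
    n                       ≡⟨ m≡m%n+[m/n]*n n 9 ⟩
    n % 9 + (n / 9) * 9     ≤⟨ +-monoˡ-≤ ((n / 9) * 9) (<⇒≤ (m%n<n n 9)) ⟩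
    9 + (n / 9) * 9         ≡⟨ cong (9 +_) (*-comm (n / 9) 9) ⟩
    9 + 9 * (n / 9)         ≡⟨ *-distribˡ-+ 9 1 (n / 9) ⟨
    9 * (1 + n / 9)         ∎
    where open ≤-Reasoning

  46n³+243n²≤34263m³ : ∀ {m n} → 430 ≤ m → n ≤ 9 * (1 + m) → 46 * n ^ 3 + 243 * n ^ 2 ≤ 34263 * m ^ 3
  46n³+243n²≤34263m³ {m} {n} 430≤m n≤9[1+m] = begin
    46 * n ^ 3 + 243 * n ^ 2
      ≤⟨ +-mono-≤ (*-monoʳ-≤ 46 (^-monoˡ-≤ 3 n≤9[1+m])) (*-monoʳ-≤ 243 (^-monoˡ-≤ 2 n≤9[1+m])) ⟩
    46 * (9 * (1 + m)) ^ 3 + 243 * (9 * (1 + m)) ^ 2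
      ≡⟨ scale 46 27 9 (1 + m) ⟩
    729 * (46 * (1 + m) ^ 3 + 27 * (1 + m) ^ 2)
      ≤⟨ *-monoʳ-≤ 729 (cubic-estimate 430≤m) ⟩
    729 * (47 * m ^ 3)
      ≡⟨ *-assoc 729 47 (m ^ 3) ⟨
    34263 * m ^ 3 ∎
    where
    open ≤-Reasoning
    scale : ∀ a b c p → a * ((c * p) * ((c * p) * ((c * p) * 1))) + b * c * ((c * p) * ((c * p) * 1))
                        ≡ c * c * c * (a * (p * (p * (p * 1))) + b * (p * (p * 1)))
    scale = solve-∀

  46*nC3≤81*E : ∀ n E → 3870 ≤ n → (n / 9) ^ 3 * 423 ≤ 6 * E + 3 * n ^ 2 → 46 * (n C 3) ≤ 81 * E
  46*nC3≤81*E n E 3870≤n lower = *-cancelˡ-≤ 6 (begin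
    6 * (46 * (n C 3))  ≡⟨ x∙yz≈y∙xz 6 46 (n C 3) ⟩
    46 * (6 * (n C 3))  ≤⟨ *-monoʳ-≤ 46 (k!*nCk≤n^k (≤-trans (s≤s (s≤s (s≤s z≤n))) 3870≤n)) ⟩
    46 * n ^ 3          ≤⟨ +-cancelʳ-≤ (243 * n ^ 2) _ _ (begin
      46 * n ^ 3 + 243 * n ^ 2   ≤⟨ 46n³+243n²≤34263m³ (/-monoˡ-≤ 9 3870≤n) (≤9*[1+n/9] n) ⟩
      34263 * m ^ 3              ≡⟨ trans (*-assoc 81 423 (m ^ 3)) (cong (81 *_) (*-comm 423 (m ^ 3))) ⟩
      81 * (m ^ 3 * 423)         ≤⟨ *-monoʳ-≤ 81 lower ⟩
      81 * (6 * E + 3 * n ^ 2)   ≡⟨ *-distribˡ-+ 81 (6 * E) (3 * n ^ 2) ⟩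
      81 * (6 * E) + 81 * (3 * n ^ 2) ≡⟨ cong₂ _+_ (*-assoc 81 6 E) (*-assoc 81 3 (n ^ 2)) ⟨
      486 * E + 243 * n ^ 2      ∎) ⟩
    486 * E             ≡⟨ *-assoc 6 81 E ⟩
    6 * (81 * E)        ∎)
    where
    open ≤-Reasoning
    m = n / 9

module RationalBound where
  open import Data.Nat as ℕ using (ℕ)
  open import Data.Integer as ℤ using (+_)
  import Data.Integer.Properties as ℤ
  import Data.Nat.Coprimality as Coprime
  open import Data.Rational
  open import Data.Rational.Properties

  toℚ≡mkℚ : ∀ m → toℚ m ≡ mkℚ (+ m) 0 (Coprime.sym (Coprime.1-coprimeTo m))
  toℚ≡mkℚ m = ↥p/↧p≡p (mkℚ (+ m) 0 (Coprime.sym (Coprime.1-coprimeTo m)))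

  toℚ-mono-≤ : ∀ {m n} → m ℕ.≤ n → toℚ m ≤ toℚ n
  toℚ-mono-≤ {m} {n} m≤n rewrite toℚ≡mkℚ m | toℚ≡mkℚ n =
    *≤* (subst₂ ℤ._≤_ (sym (ℤ.*-identityʳ (+ m))) (sym (ℤ.*-identityʳ (+ n))) (ℤ.+≤+ m≤n))

  toℚ-homo-* : ∀ m n → toℚ m * toℚ n ≡ toℚ (m ℕ.* n)
  toℚ-homo-* m n rewrite toℚ≡mkℚ m | toℚ≡mkℚ n = cong (_/ 1) (sym (ℤ.pos-* m n))

  [46/81-ε]*C≤E : ∀ ε C E → 0ℚ ≤ ε → 46 ℕ.* C ℕ.≤ 81 ℕ.* E → (+ 46 / 81 - ε) * toℚ C ≤ toℚ E
  [46/81-ε]*C≤E ε C E 0≤ε 46C≤81E = begin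
    (q - ε) * toℚ C   ≤⟨ *-monoʳ-≤-nonNeg (toℚ C) {{nonNegative (toℚ-mono-≤ {0} {C} ℕ.z≤n)}} q-ε≤q ⟩
    q * toℚ C         ≤⟨ *-cancelˡ-≤-pos (toℚ 81) (begin
      toℚ 81 * (q * toℚ C) ≡⟨ *-assoc (toℚ 81) q (toℚ C) ⟨
      toℚ 46 * toℚ C       ≡⟨ toℚ-homo-* 46 C ⟩
      toℚ (46 ℕ.* C)       ≤⟨ toℚ-mono-≤ 46C≤81E ⟩
      toℚ (81 ℕ.* E)       ≡⟨ toℚ-homo-* 81 E ⟨
      toℚ 81 * toℚ E ∎) ⟩
    toℚ E             ∎
    where
    open ≤-Reasoning
    q = + 46 / 81
    q-ε≤q : q - ε ≤ q
    q-ε≤q = subst (q - ε ≤_) (+-identityʳ q) (+-monoʳ-≤ q (neg-antimono-≤ 0≤ε))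

open import Data.Nat using (ℕ; _≥_)
open import Data.Nat.Combinatorics using (_C_)
open import Data.Integer using (+_)
open import Data.Rational using (ℚ; _/_; _-_; _*_; _≤_; _<_; 0ℚ)
open import Data.Rational.Properties using (<⇒≤)
open BlowUp using (blowUp; blowUp-K5minusFree)
open NinePartPattern using (P₉; P₉-spansNoK5minus; numEdges-blowUp-P₉-≥)
open Arithmetic using (46*nC3≤81*E)
open RationalBound using ([46/81-ε]*C≤E)

mainTheorem3 : (ε : ℚ) → 0ℚ < ε →
    Σ ℕ λ N → (n : ℕ) → n ≥ N →
      Σ (3Graph n) λ H → K5minusFree H ×
        ((((+ 46) / 81) - ε) * toℚ (n C 3) ≤ toℚ (numEdges H))
mainTheorem3 ε 0<ε = 3870 , λ n n≥3870 →
  let E = numEdges (blowUp P₉ n) in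
  blowUp P₉ n ,
  blowUp-K5minusFree P₉ n P₉-spansNoK5minus ,
  [46/81-ε]*C≤E ε (n C 3) E (<⇒≤ 0<ε) (46*nC3≤81*E n E n≥3870 (numEdges-blowUp-P₉-≥ n))
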